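{- Suppose $G$ is a connected bipartite graph with $q$ edges and bipartition $(V_1,V_2)$. If $\chi_{la}(G)=2$, then $|V_1|\ne |V_2|$ and $\binom{q+1}{2}$ is divisible by both $|V_1|$ and $|V_2|$.
   Context: All graphs are finite and simple. For a graph $G=(V,E)$ with $q$ edges, a bijection $f:E\to\{1,2,\ldots,q\}$ is a local antimagic labeling if $f^+(u)\ne f^+(v)$ for every pair of adjacent vertices $u,v$, where $f^+(u)=\sum_{e\in E(u)} f(e)$ and $E(u)$ is the set of edges incident to $u$. Such a labeling induces a proper vertex coloring $v\mapsto f^+(v)$. The local antimagic chromatic number $\chi_{la}(G)$ is the minimum number of distinct values of $f^+$ taken over all local antimagic labelings $f$ of $G$. -}

module Defs where

open import Data.Nat using (ℕ; suc; _≤_)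
open import Data.Nat.Properties using () renaming (_≟_ to _≟ℕ_)
open import Data.Fin using (Fin; toℕ; _≟_)
open import Data.Fin.Permutation using (Permutation′; _⟨$⟩ʳ_)
open import Data.Bool using (Bool; true; false; if_then_else_; _∨_; not; T?)
open import Data.Nat.ListAction using (sum)
open import Data.List using (List; []; _∷_; map; length; allFin; deduplicate; filter)
open import Data.Product using (Σ; ∃; ∃-syntax; _×_; _,_; proj₁; proj₂)
open import Data.Sum using (_⊎_)
open import Relation.Nullary using (¬_; does)
open import Relation.Binary.PropositionalEquality using (_≡_; _≢_)

record Graph : Set where
  field
    n    : ℕ
    q    : ℕ
    ends : Fin q → Fin n × Fin n
    loopless : ∀ e → proj₁ (ends e) ≢ proj₂ (ends e)
    simple : ∀ e e' →
      (ends e ≡ ends e' ⊎ (proj₁ (ends e) ≡ proj₂ (ends e') × proj₂ (ends e) ≡ proj₁ (ends e'))) →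
      e ≡ e'

open Graph public

Adj : (G : Graph) → Fin (n G) → Fin (n G) → Set
Adj G u v = ∃[ e ] (ends G e ≡ (u , v) ⊎ ends G e ≡ (v , u))

data Walk (G : Graph) : Fin (n G) → Fin (n G) → Set where
  here : ∀ {u} → Walk G u u
  step : ∀ {u v w} → Adj G u v → Walk G v w → Walk G u w

Connected : Graph → Set
Connected G = ∀ u v → Walk G u v

-- a bipartition (V₁ , V₂) given by its indicator: V₁ = side⁻¹(true), V₂ = side⁻¹(false);
-- every edge has one end in each part
IsBipartition : (G : Graph) → (Fin (n G) → Bool) → Set
IsBipartition G side = ∀ u v → Adj G u v → side u ≢ side v

card₁ : (G : Graph) → (Fin (n G) → Bool) → ℕ
card₁ G side = length (filter (λ v → T? (side v)) (allFin (n G)))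

card₂ : (G : Graph) → (Fin (n G) → Bool) → ℕ
card₂ G side = length (filter (λ v → T? (not (side v))) (allFin (n G)))

-- an edge labeling: bijection E → {1,…,q}, given by a permutation of Fin q;
-- the label of e is 1 + toℕ (π e)
Labeling : Graph → Set
Labeling G = Permutation′ (q G)

label : (G : Graph) → Labeling G → Fin (q G) → ℕ
label G f e = suc (toℕ (f ⟨$⟩ʳ e))

incident : (G : Graph) → Fin (n G) → Fin (q G) → Bool
incident G u e = does (u ≟ proj₁ (ends G e)) ∨ does (u ≟ proj₂ (ends G e))

fplus : (G : Graph) → Labeling G → Fin (n G) → ℕ
fplus G f u = sum (map (λ e → if incident G u e then label G f e else 0) (allFin (q G)))

IsLocalAntimagic : (G : Graph) → Labeling G → Set
IsLocalAntimagic G f = ∀ u v → Adj G u v → fplus G f u ≢ fplus G f v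

numColors : (G : Graph) → Labeling G → ℕ
numColors G f = length (deduplicate _≟ℕ_ (map (fplus G f) (allFin (n G))))

ChiLa≡ : Graph → ℕ → Set
ChiLa≡ G k =
  (Σ (Labeling G) λ f → IsLocalAntimagic G f × numColors G f ≡ k) ×
  (∀ f → IsLocalAntimagic G f → k ≤ numColors G f)

{-# OPTIONS --safe #-}
-- Let f be a local antimagic labeling with exactly two vertex colours. In a
-- connected bipartite graph a proper colouring with two colours is constant on
-- each side, say c₁ on V₁ and c₂ on V₂ with c₁ ≠ c₂. Every edge has exactly one
-- end in V₁, so summing f⁺ over V₁ counts each label once:
-- |V₁| c₁ = 1 + 2 + ⋯ + q = C(q+1,2), and likewise |V₂| c₂ = C(q+1,2).
-- Both divisibilities follow, and |V₁| = |V₂| would force c₁ = c₂.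
module Submission where

open import Defs
open import Data.Nat using (ℕ; zero; suc; _+_; _*_; _>_; NonZero; >-nonZero)
open import Data.Nat.Properties using (+-0-commutativeMonoid; +-identityʳ; +-comm; *-cancelˡ-≡)
  renaming (_≟_ to _≟ℕ_)
open import Data.Nat.Divisibility using (_∣_; m∣m*n)
open import Data.Nat.Combinatorics using (_C_; nC1≡n; nCk+nC[k+1]≡[n+1]C[k+1])
open import Data.Nat.ListAction using (sum)
open import Data.Bool using (Bool; true; false; if_then_else_; not; _∨_; T?)
open import Data.Bool.Properties using (¬-not; not-injective; ∨-zeroʳ; T-≡)
open import Data.Fin using (Fin; toℕ; _≟_; inject₁; fromℕ; punchIn)
import Data.Fin as Fin
open import Data.Fin.Properties using (toℕ-inject₁; toℕ-fromℕ; punchInᵢ≢i)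
open import Data.List using (List; []; _∷_; map; length; allFin; deduplicate; filter; tabulate)
open import Data.List.Properties using (map-tabulate; filter-some)
open import Data.List.Membership.Propositional using (_∈_; lose)
open import Data.List.Membership.Propositional.Properties
  using (∈-map⁺; ∈-map⁻; ∈-allFin; ∈-deduplicate⁺; ∈-deduplicate⁻)
open import Data.List.Relation.Unary.Any using (here; there)
open import Data.List.Relation.Unary.AllPairs using (_∷_)
open import Data.List.Relation.Unary.All using ([]; _∷_)
open import Data.List.Relation.Unary.Unique.DecPropositional.Properties using (deduplicate-!)
open import Data.Product using (_×_; _,_; proj₁; proj₂; ∃₂)
open import Data.Sum using (_⊎_; inj₁; inj₂; swap)
open import Function using (_∘_; id)
open import Function.Bundles using (Equivalence)
open import Relation.Nullary using (contradiction; yes; no; does)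
open import Relation.Nullary.Decidable using (dec-true)
open import Relation.Binary.PropositionalEquality
  using (_≡_; _≢_; refl; sym; trans; cong; cong₂; ≢-sym; module ≡-Reasoning)
open import Algebra.Properties.CommutativeMonoid.Sum +-0-commutativeMonoid
  using (sum-cong-≗; sum-replicate-zero; sum-init-last; sum-remove; ∑-comm; ∑-permute)
  renaming (sum to ∑)

open ≡-Reasoning

sum-tabulate : ∀ {n} (h : Fin n → ℕ) → sum (tabulate h) ≡ ∑ h
sum-tabulate {zero}  h = refl
sum-tabulate {suc n} h = cong (h Fin.zero +_) (sum-tabulate (h ∘ Fin.suc))

sum-map-allFin : ∀ {n} (h : Fin n → ℕ) → sum (map h (allFin n)) ≡ ∑ h
sum-map-allFin h = trans (cong sum (map-tabulate id h)) (sum-tabulate h)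

∑-supported-at : ∀ {n} (h : Fin n → ℕ) x → (∀ u → u ≢ x → h u ≡ 0) → ∑ h ≡ h x
∑-supported-at {suc n} h x vanishes = begin
  ∑ h                         ≡⟨ sum-remove {i = x} h ⟩
  h x + ∑ (h ∘ punchIn x)     ≡⟨ cong (h x +_) (sum-cong-≗ (λ i → vanishes _ (punchInᵢ≢i x i))) ⟩
  h x + ∑ {n} (λ _ → 0)       ≡⟨ cong (h x +_) (sum-replicate-zero n) ⟩
  h x + 0                     ≡⟨ +-identityʳ (h x) ⟩
  h x                         ∎

if-∑ : ∀ {n} b (h : Fin n → ℕ) → (if b then ∑ h else 0) ≡ ∑ (λ i → if b then h i else 0)
if-∑ true  h = refl
if-∑ {n} false h = sym (sum-replicate-zero n)

∑-suc-toℕ : ∀ q → ∑ {q} (λ i → suc (toℕ i)) ≡ suc q C 2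
∑-suc-toℕ zero    = refl
∑-suc-toℕ (suc q) = begin
  ∑ {suc q} (λ i → suc (toℕ i))                            ≡⟨ sum-init-last (λ i → suc (toℕ i)) ⟩
  ∑ {q} (λ i → suc (toℕ (inject₁ i))) + suc (toℕ (fromℕ q)) ≡⟨ cong₂ _+_ init≡ (cong suc (toℕ-fromℕ q)) ⟩
  suc q C 2 + suc q                                        ≡⟨ +-comm (suc q C 2) (suc q) ⟩
  suc q + suc q C 2                                        ≡⟨ cong (_+ suc q C 2) (nC1≡n (suc q)) ⟨
  suc q C 1 + suc q C 2                                    ≡⟨ nCk+nC[k+1]≡[n+1]C[k+1] (suc q) 1 ⟩
  suc (suc q) C 2                                          ∎
  where
  init≡ : ∑ {q} (λ i → suc (toℕ (inject₁ i))) ≡ suc q C 2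
  init≡ = trans (sum-cong-≗ {q} (cong suc ∘ toℕ-inject₁)) (∑-suc-toℕ q)

∑-label : ∀ G (f : Labeling G) → ∑ (label G f) ≡ suc (q G) C 2
∑-label G f = trans (sym (∑-permute (λ i → suc (toℕ i)) f)) (∑-suc-toℕ (q G))

sum-guarded-const : ∀ {X : Set} (P : X → Bool) (h : X → ℕ) {c} →
  (∀ u → P u ≡ true → h u ≡ c) →
  ∀ xs → sum (map (λ u → if P u then h u else 0) xs) ≡ length (filter (λ v → T? (P v)) xs) * c
sum-guarded-const P h const []       = refl
sum-guarded-const P h const (x ∷ xs) with P x in Px
... | true  = cong₂ _+_ (const x Px) (sum-guarded-const P h const xs)
... | false = sum-guarded-const P h const xs

∈-pair : ∀ {A : Set} {a b x : A} → x ∈ a ∷ b ∷ [] → x ≡ a ⊎ x ≡ b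
∈-pair (here x≡a)         = inj₁ x≡a
∈-pair (there (here x≡b)) = inj₂ x≡b

deduplicate-length≡2 : (xs : List ℕ) → length (deduplicate _≟ℕ_ xs) ≡ 2 →
  ∃₂ λ a b → a ∈ xs × b ∈ xs × a ≢ b × (∀ {x} → x ∈ xs → x ≡ a ⊎ x ≡ b)
deduplicate-length≡2 xs len
  with deduplicate _≟ℕ_ xs | deduplicate-! _≟ℕ_ xs | ∈-deduplicate⁻ _≟ℕ_ xs | ∈-deduplicate⁺ _≟ℕ_ {xs}
... | a ∷ b ∷ [] | (a≢b ∷ []) ∷ _ | from | to =
  a , b , from (here refl) , from (there (here refl)) , a≢b , ∈-pair ∘ to

two-colours : ∀ {n} (c : Fin n → ℕ) → length (deduplicate _≟ℕ_ (map c (allFin n))) ≡ 2 →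
  ∃₂ λ u v → c u ≢ c v × (∀ w → c w ≡ c u ⊎ c w ≡ c v)
two-colours c len with deduplicate-length≡2 _ len
... | a , b , a∈ , b∈ , a≢b , within with ∈-map⁻ c a∈ | ∈-map⁻ c b∈
...   | u , _ , refl | v , _ , refl = u , v , a≢b , λ w → within (∈-map⁺ c (∈-allFin w))

≢-≢⇒≡ : ∀ {A : Set} {α β x y z : A} →
  x ≡ α ⊎ x ≡ β → y ≡ α ⊎ y ≡ β → z ≡ α ⊎ z ≡ β → x ≢ y → y ≢ z → x ≡ z
≢-≢⇒≡ (inj₁ refl) (inj₁ refl) _           x≢y _   = contradiction refl x≢y
≢-≢⇒≡ (inj₂ refl) (inj₂ refl) _           x≢y _   = contradiction refl x≢y
≢-≢⇒≡ _           (inj₁ refl) (inj₁ refl) _   y≢z = contradiction refl y≢z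
≢-≢⇒≡ _           (inj₂ refl) (inj₂ refl) _   y≢z = contradiction refl y≢z
≢-≢⇒≡ (inj₁ refl) (inj₂ refl) (inj₁ refl) _   _   = refl
≢-≢⇒≡ (inj₂ refl) (inj₁ refl) (inj₂ refl) _   _   = refl

ProperColouring : {A : Set} (G : Graph) → (Fin (n G) → A) → Set
ProperColouring G c = ∀ u v → Adj G u v → c u ≢ c v

module _ {A : Set} (G : Graph) {side : Fin (n G) → Bool} (bip : IsBipartition G side)
         {c : Fin (n G) → A} (proper : ProperColouring G c)
         {α β : A} (two-valued : ∀ u → c u ≡ α ⊎ c u ≡ β) where

  walk-parity : ∀ {u v} → Walk G u v →
    (side u ≡ side v → c u ≡ c v) × (side u ≢ side v → c u ≢ c v)
  walk-parity here = (λ _ → refl) , (λ s≢s → contradiction refl s≢s)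
  walk-parity {u} {v} (step {v = w} u~w w⇝v) = same , different
    where
    ih = walk-parity w⇝v

    same : side u ≡ side v → c u ≡ c v
    same su≡sv = ≢-≢⇒≡ (two-valued u) (two-valued w) (two-valued v) (proper u w u~w)
      (proj₂ ih (λ sw≡sv → bip u w u~w (trans su≡sv (sym sw≡sv))))

    different : side u ≢ side v → c u ≢ c v
    different su≢sv cu≡cv = proper u w u~w (trans cu≡cv (sym (proj₁ ih sw≡sv)))
      where
      sw≡sv : side w ≡ side v
      sw≡sv = not-injective (trans (sym (¬-not (bip u w u~w))) (¬-not su≢sv))

  sameSide⇒sameColour : Connected G → ∀ u v → side u ≡ side v → c u ≡ c v
  sameSide⇒sameColour connected u v = proj₁ (walk-parity (connected u v))

incident-ends : ∀ G u e → incident G u e ≡ true → u ≡ proj₁ (ends G e) ⊎ u ≡ proj₂ (ends G e)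
incident-ends G u e inc with u ≟ proj₁ (ends G e) | u ≟ proj₂ (ends G e)
incident-ends G u e inc  | yes u≡x | _       = inj₁ u≡x
incident-ends G u e inc  | no _    | yes u≡y = inj₂ u≡y
incident-ends G u e ()   | no _    | no _

incident-end₁ : ∀ G e → incident G (proj₁ (ends G e)) e ≡ true
incident-end₁ G e = cong (_∨ does (x ≟ y)) (dec-true (x ≟ x) refl)
  where
  x = proj₁ (ends G e)
  y = proj₂ (ends G e)

incident-end₂ : ∀ G e → incident G (proj₂ (ends G e)) e ≡ true
incident-end₂ G e = trans (cong (does (y ≟ x) ∨_) (dec-true (y ≟ y) refl)) (∨-zeroʳ (does (y ≟ x)))
  where
  x = proj₁ (ends G e)
  y = proj₂ (ends G e)

∑-guarded-at-one-end : ∀ {n} (P inc : Fin n → Bool) (w : ℕ) {a b : Fin n} →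
  P a ≡ true → P b ≡ false → inc a ≡ true → (∀ u → inc u ≡ true → u ≡ a ⊎ u ≡ b) →
  ∑ (λ u → if P u then (if inc u then w else 0) else 0) ≡ w
∑-guarded-at-one-end P inc w {a} {b} Pa Pb inc-a inc⇒ends =
  trans (∑-supported-at _ a vanishes) (cong₂ (λ p i → if p then (if i then w else 0) else 0) Pa inc-a)
  where
  vanishes : ∀ u → u ≢ a → (if P u then (if inc u then w else 0) else 0) ≡ 0
  vanishes u u≢a with P u in Pu | inc u in inc-u
  ... | false | _     = refl
  ... | true  | false = refl
  ... | true  | true  with inc⇒ends u inc-u
  ...   | inj₁ u≡a  = contradiction u≡a u≢a
  ...   | inj₂ refl = contradiction (trans (sym Pu) Pb) λ ()

module _ (G : Graph) {P : Fin (n G) → Bool} (bip : IsBipartition G P) where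

  ∑-side-incident : ∀ (w : ℕ) e → ∑ (λ u → if P u then (if incident G u e then w else 0) else 0) ≡ w
  ∑-side-incident w e with P (proj₁ (ends G e)) in Px | P (proj₂ (ends G e)) in Py
  ... | true  | false = ∑-guarded-at-one-end P (λ u → incident G u e) w Px Py
                          (incident-end₁ G e) (λ u → incident-ends G u e)
  ... | false | true  = ∑-guarded-at-one-end P (λ u → incident G u e) w Py Px
                          (incident-end₂ G e) (λ u → swap ∘ incident-ends G u e)
  ... | true  | true  = contradiction (trans Px (sym Py)) (bip _ _ (e , inj₁ refl))
  ... | false | false = contradiction (trans Px (sym Py)) (bip _ _ (e , inj₁ refl))

  ∑-side-fplus : ∀ f → ∑ (λ u → if P u then fplus G f u else 0) ≡ suc (q G) C 2
  ∑-side-fplus f = begin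
    ∑ (λ u → if P u then fplus G f u else 0)     ≡⟨ sum-cong-≗ fplus-as-∑ ⟩
    ∑ (λ u → ∑ (λ e → if P u then w u e else 0)) ≡⟨ ∑-comm (λ u e → if P u then w u e else 0) ⟩
    ∑ (λ e → ∑ (λ u → if P u then w u e else 0)) ≡⟨ sum-cong-≗ (λ e → ∑-side-incident (label G f e) e) ⟩
    ∑ (label G f)                                ≡⟨ ∑-label G f ⟩
    suc (q G) C 2                                ∎
    where
    w : Fin (n G) → Fin (q G) → ℕ
    w u e = if incident G u e then label G f e else 0

    fplus-as-∑ : ∀ u → (if P u then fplus G f u else 0) ≡ ∑ (λ e → if P u then w u e else 0)
    fplus-as-∑ u = trans (cong (λ s → if P u then s else 0) (sum-map-allFin (w u))) (if-∑ (P u) (w u))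

  card₁-*-colour : ∀ f {c} → (∀ u → P u ≡ true → fplus G f u ≡ c) → card₁ G P * c ≡ suc (q G) C 2
  card₁-*-colour f {c} constant = begin
    card₁ G P * c                    ≡⟨ sum-guarded-const P (fplus G f) constant (allFin (n G)) ⟨
    sum (map guarded (allFin (n G))) ≡⟨ sum-map-allFin guarded ⟩
    ∑ guarded                        ≡⟨ ∑-side-fplus f ⟩
    suc (q G) C 2                    ∎
    where
    guarded : Fin (n G) → ℕ
    guarded u = if P u then fplus G f u else 0

card₁-positive : ∀ G (P : Fin (n G) → Bool) {w} → P w ≡ true → card₁ G P > 0
card₁-positive G P {w} Pw = filter-some (λ v → T? (P v)) (lose (∈-allFin w) (Equivalence.from T-≡ Pw))

IsBipartition-not : ∀ G {side} → IsBipartition G side → IsBipartition G (not ∘ side)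
IsBipartition-not G bip u v u~v = bip u v u~v ∘ not-injective

equal-products-≢ʳ⇒≢ˡ : ∀ {k₁ k₂ c₁ c₂ t} .{{_ : NonZero k₁}} →
  c₁ ≢ c₂ → k₁ * c₁ ≡ t → k₂ * c₂ ≡ t → k₁ ≢ k₂
equal-products-≢ʳ⇒≢ˡ {k₁} {c₁ = c₁} {c₂} c₁≢c₂ k₁c₁≡t k₁c₂≡t refl =
  c₁≢c₂ (*-cancelˡ-≡ c₁ c₂ k₁ (trans k₁c₁≡t (sym k₁c₂≡t)))

m*n≡o⇒m∣o : ∀ {m n o} → m * n ≡ o → m ∣ o
m*n≡o⇒m∣o {n = n} refl = m∣m*n n

module _ (G : Graph) {side : Fin (n G) → Bool} (bip : IsBipartition G side) (f : Labeling G)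
         (same-colour : ∀ u v → side u ≡ side v → fplus G f u ≡ fplus G f v) where

  counts-from-opposite-vertices : ∀ {w₁ w₂} → side w₁ ≡ true → side w₂ ≡ false → fplus G f w₁ ≢ fplus G f w₂ →
    (card₁ G side ≢ card₂ G side) × (card₁ G side ∣ (suc (q G) C 2)) × (card₂ G side ∣ (suc (q G) C 2))
  counts-from-opposite-vertices {w₁} {w₂} s₁ s₂ c₁≢c₂ =
    equal-products-≢ʳ⇒≢ˡ {{>-nonZero (card₁-positive G side s₁)}} c₁≢c₂ k₁c₁≡t k₂c₂≡t ,
    m*n≡o⇒m∣o k₁c₁≡t , m*n≡o⇒m∣o k₂c₂≡t
    where
    k₁c₁≡t : card₁ G side * fplus G f w₁ ≡ suc (q G) C 2
    k₁c₁≡t = card₁-*-colour G bip f (λ u su → same-colour u w₁ (trans su (sym s₁)))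

    -- card₂ G side unfolds to card₁ G (not ∘ side).
    k₂c₂≡t : card₂ G side * fplus G f w₂ ≡ suc (q G) C 2
    k₂c₂≡t = card₁-*-colour G (IsBipartition-not G bip) f
               (λ u nsu → same-colour u w₂ (not-injective (trans nsu (cong not (sym s₂)))))

  counts-from-distinct-colours : ∀ u v → fplus G f u ≢ fplus G f v →
    (card₁ G side ≢ card₂ G side) × (card₁ G side ∣ (suc (q G) C 2)) × (card₂ G side ∣ (suc (q G) C 2))
  counts-from-distinct-colours u v cu≢cv with side u in su | side v in sv
  ... | true  | false = counts-from-opposite-vertices su sv cu≢cv
  ... | false | true  = counts-from-opposite-vertices sv su (≢-sym cu≢cv)
  ... | true  | true  = contradiction (same-colour u v (trans su (sym sv))) cu≢cv
  ... | false | false = contradiction (same-colour u v (trans su (sym sv))) cu≢cv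

corollary1p2 : (G : Graph) → Connected G →
    (side : Fin (n G) → Bool) → IsBipartition G side →
    ChiLa≡ G 2 →
    (card₁ G side ≢ card₂ G side) ×
      (card₁ G side ∣ (suc (q G) C 2)) × (card₂ G side ∣ (suc (q G) C 2))
corollary1p2 G connected side bip ((f , antimagic , numColors≡2) , _) =
  let u , v , fu≢fv , two-valued = two-colours (fplus G f) numColors≡2
      same-colour = sameSide⇒sameColour G bip antimagic two-valued connected
  in counts-from-distinct-colours G bip f same-colour u v fu≢fv
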